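{- Let the integer matrices $(a(i,j))_{i,j\ge1}$ and $(b(i,j))_{i,j\ge1}$ be defined as follows (all entries not specified, and all entries with an index $\le 0$, are $0$). For $1\le i\le 3$ the nonzero entries are: $(a(1,1),a(1,2),a(1,3))=(10,-36,27)$; $(a(2,1),\dots,a(2,6))=(-8,306,-2160,5508,-5832,2187)$; $(a(3,1),\dots,a(3,9))=(1,-360,10566,-99144,423549,-944784,1141614,-708588,177147)$; $(b(1,1),\dots,b(1,4))=(-9,252,-891,729)$; $(b(2,1),\dots,b(2,7))=(1,-378,8613,-54675,138510,-150903,59049)$; $(b(3,1),\dots,b(3,10))=(0,147,-14553,312255,-2617839,10764414,-23914845,29288304,-18600435,4782969)$. For $i\ge4$, both $m=a$ and $m=b$ satisfy $m(i,j)=30m(i-1,j-1)-108m(i-1,j-2)+81m(i-1,j-3)-12m(i-2,j-1)+9m(i-2,j-2)+m(i-3,j-1)$. Define integer sequences $d_\alpha=(d_\alpha(j))_{j\ge1}$ for $\alpha\ge1$ by $d_1=(9,0,0,\dots)$ and, for $\alpha\ge2$, $d_\alpha(j)=\sum_{k\ge1}a(k,j)d_{\alpha-1}(k)$ if $\alpha$ is even and $d_\alpha(j)=\sum_{k\ge1}b(k,j)d_{\alpha-1}(k)$ if $\alpha$ is odd. Then for all $\alpha,j\ge1$, $$\pi(d_{2\alpha-1}(j))\ge 2\alpha+\left\lfloor\frac{2j-2}{3}\right\rfloor.$$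
   Context: $\pi(n)$ denotes the $3$-adic order of an integer $n$, with $\pi(0)=\infty$; $\lfloor x\rfloor$ is the largest integer not exceeding $x$. -}

module Defs where

open import Data.Bool using (Bool; true; false; if_then_else_)
open import Data.Nat using (ℕ; zero; suc; _≤ᵇ_; _∸_) renaming (_+_ to _+ℕ_; _*_ to _*ℕ_)
open import Data.Integer using (ℤ; +_; -_; _+_; _*_; _-_)
open import Data.List using (List; []; _∷_)

-- 1-based lookup of a finite list of integers; everything else (index 0 or beyond) is 0.
row : List ℤ → ℕ → ℤ
row []       _             = + 0
row (x ∷ xs) zero          = + 0
row (x ∷ xs) (suc zero)    = x
row (x ∷ xs) (suc (suc j)) = row xs (suc j)

shift : (ℕ → ℤ) → ℕ → ℕ → ℤ
shift f k j = if j ≤ᵇ k then + 0 else f (j ∸ k)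

recur : (ℕ → ℤ) → (ℕ → ℤ) → (ℕ → ℤ) → ℕ → ℤ
recur m1 m2 m3 j =
  + 30 * shift m1 1 j - + 108 * shift m1 2 j + + 81 * shift m1 3 j
  - + 12 * shift m2 1 j + + 9 * shift m2 2 j + shift m3 1 j

a : ℕ → ℕ → ℤ
a zero j = + 0
a (suc zero) = row (+ 10 ∷ - + 36 ∷ + 27 ∷ [])
a (suc (suc zero)) = row (- + 8 ∷ + 306 ∷ - + 2160 ∷ + 5508 ∷ - + 5832 ∷ + 2187 ∷ [])
a (suc (suc (suc zero))) =
  row (+ 1 ∷ - + 360 ∷ + 10566 ∷ - + 99144 ∷ + 423549 ∷ - + 944784 ∷ + 1141614
       ∷ - + 708588 ∷ + 177147 ∷ [])
a (suc (suc (suc (suc i)))) = recur (a (suc (suc (suc i)))) (a (suc (suc i))) (a (suc i))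

b : ℕ → ℕ → ℤ
b zero j = + 0
b (suc zero) = row (- + 9 ∷ + 252 ∷ - + 891 ∷ + 729 ∷ [])
b (suc (suc zero)) =
  row (+ 1 ∷ - + 378 ∷ + 8613 ∷ - + 54675 ∷ + 138510 ∷ - + 150903 ∷ + 59049 ∷ [])
b (suc (suc (suc zero))) =
  row (+ 0 ∷ + 147 ∷ - + 14553 ∷ + 312255 ∷ - + 2617839 ∷ + 10764414 ∷ - + 23914845
       ∷ + 29288304 ∷ - + 18600435 ∷ + 4782969 ∷ [])
b (suc (suc (suc (suc i)))) = recur (b (suc (suc (suc i)))) (b (suc (suc i))) (b (suc i))

sumTo : ℕ → (ℕ → ℤ) → ℤ
sumTo zero    f = + 0
sumTo (suc n) f = sumTo n f + f (suc n)

isEven : ℕ → Bool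
isEven zero          = true
isEven (suc zero)    = false
isEven (suc (suc n)) = isEven n

-- support bound: d α (j) = 0 for j > suppBound α  (suppBound 0 = 0, suppBound 1 = 1, suppBound (α+1) = 3·suppBound α + 1),
-- since row k of a vanishes beyond column 3k and row k of b beyond column 3k+1.
suppBound : ℕ → ℕ
suppBound zero    = 0
suppBound (suc α) = 3 *ℕ suppBound α +ℕ 1

-- d α j for α, j ≥ 1 (index 0 gives 0).  The sum over k ≥ 1 is truncated at
-- suppBound (α-1), beyond which d (α-1) vanishes, so it equals the infinite sum.
d : ℕ → ℕ → ℤ
d zero j = + 0
d (suc zero) j = row (+ 9 ∷ []) j
d (suc (suc α)) j =
  sumTo (suppBound (suc α))
        (λ k → (if isEven (suc (suc α)) then a k j else b k j) * d (suc α) k)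

-- "π(x) ≥ n" for the 3-adic order π (with π(0) = ∞): 3^n divides x.
open import Data.Integer.Divisibility using (_∣_)
open import Data.Nat using (_^_)

ord3≥ : ℤ → ℕ → Set
ord3≥ x n = + (3 ^ n) ∣ x

module Submission where

open import Defs
open import Data.Nat using (ℕ; _≤_; _+_; _*_; _∸_; _/_)

-- Say a sequence f "rises with offset r" when
--     π(f j) ≥ n whenever 2n + r < 3j.  Row i of a and of b rises with
--     offset i: rows 1-3 are checked entry by entry (by computation), and the
--     recurrence preserves the property because every term c·m(i-t, j-s) of
--     it satisfies 3s ≤ 2·π(c) + t  (shifting by s costs 3s in the offset,
--     the factor c gives back 2·π(c), and row i-t starts t lower).
--
-- By induction on α, with E = 2α:
--       odd  step  π(d_{2α-1}(k)) ≥ E + n   whenever 3n + 2 ≤ 2k,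
--       even step  π(d_{2α}(j))   ≥ E + g(j),  g(1) = 0, g(j) = j for j ≥ 2.
--     Each step bounds every summand a(k,j)·d(k) resp. b(k,l)·d(k) by
--     splitting the required power of 3 between the two factors, using (1);
--     only column 2 of a and row 1 of b need their explicit entries.
-- The theorem is the odd statement at n = ⌊(2j-2)/3⌋.

open import Data.Nat using (zero; suc; _^_; _%_; _<_; _≤?_; _≤ᵇ_; z≤n; s≤s; NonZero)
import Data.Nat.Properties as ℕₚ
open import Data.Nat.DivMod using (m≡m%n+[m/n]*n; m%n<n; m/n*n≤m; m*n/n≡m; /-monoˡ-≤)
import Data.Nat.Divisibility as ℕ∣
open import Data.Nat.Tactic.RingSolver using (solve)
open import Data.Integer using (ℤ; +_; -_) renaming (_+_ to _+ᶻ_; _*_ to _*ᶻ_; _-_ to _-ᶻ_)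
import Data.Integer as ℤ
import Data.Integer.Properties as ℤₚ
open import Data.Integer.Divisibility.Signed
  using (divides; ∣ᵤ⇒∣; ∣⇒∣ᵤ; ∣-trans; ∣m∣n⇒∣m+n; ∣m∣n⇒∣m-n; ∣n⇒∣m*n; *-monoˡ-∣; *-monoʳ-∣)
  renaming (_∣_ to _∣ₛ_)
open import Data.List using ([]; _∷_)
open import Data.Bool using (true; false; T; if_then_else_)
open import Data.Unit using (⊤)
open import Data.Product using (_×_; _,_)
open import Data.Sum using (inj₁; inj₂)
open import Relation.Nullary using (yes; no)
open import Relation.Nullary.Decidable using (True; toWitness)
open import Relation.Binary.PropositionalEquality using (_≡_; refl; sym; trans; cong; subst; subst₂)

-- "π(x) ≥ n", wrapped in a record so that n and x can be inferred
infix 4 3^_∣_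
record 3^_∣_ (n : ℕ) (x : ℤ) : Set where
  constructor pow∣
  field divides-x : + (3 ^ n) ∣ₛ x
open 3^_∣_

∣-zero : ∀ {n} → 3^ n ∣ + 0
∣-zero = pow∣ (divides (+ 0) refl)

∣-+ : ∀ {n x y} → 3^ n ∣ x → 3^ n ∣ y → 3^ n ∣ x +ᶻ y
∣-+ (pow∣ hx) (pow∣ hy) = pow∣ (∣m∣n⇒∣m+n hx hy)

∣-- : ∀ {n x y} → 3^ n ∣ x → 3^ n ∣ y → 3^ n ∣ x -ᶻ y
∣-- (pow∣ hx) (pow∣ hy) = pow∣ (∣m∣n⇒∣m-n hx hy)

∣-*ˡ : ∀ {n} x {y} → 3^ n ∣ y → 3^ n ∣ x *ᶻ y
∣-*ˡ x (pow∣ hy) = pow∣ (∣n⇒∣m*n x hy)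

∣-weaken : ∀ {m n x} → m ≤ n → 3^ n ∣ x → 3^ m ∣ x
∣-weaken {m} m≤n (pow∣ h) with ℕₚ.m≤n⇒∃[o]m+o≡n m≤n
... | k , refl = pow∣ (∣-trans (∣ᵤ⇒∣ 3^m∣3^[m+k]) h)
  where
  3^m∣3^[m+k] : 3 ^ m ℕ∣.∣ 3 ^ (m + k)
  3^m∣3^[m+k] = ℕ∣.divides (3 ^ k) (trans (ℕₚ.^-distribˡ-+-* 3 m k) (ℕₚ.*-comm (3 ^ m) (3 ^ k)))

∣-* : ∀ {m n x y} → 3^ m ∣ x → 3^ n ∣ y → 3^ (m + n) ∣ x *ᶻ y
∣-* {m} {n} {x} {y} (pow∣ hx) (pow∣ hy) =
  pow∣ (subst (_∣ₛ x *ᶻ y) (sym 3^[m+n]) (∣-trans (*-monoˡ-∣ (+ (3 ^ n)) hx) (*-monoʳ-∣ x hy)))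
  where
  3^[m+n] : + (3 ^ (m + n)) ≡ + (3 ^ m) *ᶻ + (3 ^ n)
  3^[m+n] = trans (cong +_ (ℕₚ.^-distribˡ-+-* 3 m n)) (ℤₚ.pos-* (3 ^ m) (3 ^ n))

∣-lit : ∀ (c : ℤ) v → {True (3 ^ v ℕ∣.∣? ℤ.∣ c ∣)} → 3^ v ∣ c
∣-lit c v {ok} = pow∣ (∣ᵤ⇒∣ (toWitness ok))

-- To get π(xy) ≥ E + t from π(y) ≥ E + e, it suffices that π(x) ≥ p for
-- the missing amount p = t - e (nothing is needed from x when t ≤ e).
∣-split : ∀ {x y} E t e → (∀ p → t ≡ p + e → 3^ p ∣ x) → 3^ (E + e) ∣ y → 3^ (E + t) ∣ x *ᶻ y
∣-split {x} {y} E t e hx hy with t ≤? e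
... | yes t≤e = ∣-*ˡ x (∣-weaken (ℕₚ.+-monoʳ-≤ E t≤e) hy)
... | no t≰e  = subst (λ u → 3^ u ∣ x *ᶻ y) exponent (∣-* (hx (t ∸ e) (sym t∸e+e)) hy)
  where
  t∸e+e : t ∸ e + e ≡ t
  t∸e+e = ℕₚ.m∸n+n≡m (ℕₚ.<⇒≤ (ℕₚ.≰⇒> t≰e))
  exponent : t ∸ e + (E + e) ≡ E + t
  exponent = trans (rearrange (t ∸ e) E e) (cong (λ u → E + u) t∸e+e)
    where
    rearrange : ∀ p E e → p + (E + e) ≡ E + (p + e)
    rearrange p E e = solve (p ∷ E ∷ e ∷ [])

∣-sum : ∀ {n} N f → (∀ k → 3^ n ∣ f (suc k)) → 3^ n ∣ sumTo N f
∣-sum zero    f h = ∣-zero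
∣-sum (suc N) f h = ∣-+ (∣-sum N f h) (h N)

≤-quotient : ∀ a c {m n} .{{_ : NonZero a}} → a * n + c ≤ m → n ≤ (m ∸ c) / a
≤-quotient a c {m} {n} h = begin
  n            ≡⟨ sym (m*n/n≡m n a) ⟩
  n * a / a    ≤⟨ /-monoˡ-≤ a (ℕₚ.m+n≤o⇒m≤o∸n (n * a) (subst (λ u → u + c ≤ m) (ℕₚ.*-comm a n) h)) ⟩
  (m ∸ c) / a  ∎
  where open ℕₚ.≤-Reasoning

gain : ℕ → ℕ
gain k = (2 * k ∸ 2) / 3

gain-lower : ∀ k → 1 ≤ k → 3 * gain k + 2 ≤ 2 * k
gain-lower k 1≤k = ℕₚ.m≤o∸n⇒m+n≤o (3 * gain k) (ℕₚ.*-monoʳ-≤ 2 1≤k)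
  (subst (_≤ 2 * k ∸ 2) (ℕₚ.*-comm (gain k) 3) (m/n*n≤m (2 * k ∸ 2) 3))

gain-upper : ∀ k → 2 * k ≤ 3 * gain k + 4
gain-upper k = begin
  2 * k                                  ≤⟨ ℕₚ.m≤n+m∸n (2 * k) 2 ⟩
  2 + (2 * k ∸ 2)                        ≡⟨ cong (λ u → 2 + u) (m≡m%n+[m/n]*n (2 * k ∸ 2) 3) ⟩
  2 + ((2 * k ∸ 2) % 3 + gain k * 3)   ≤⟨ ℕₚ.+-monoʳ-≤ 2 (ℕₚ.+-monoˡ-≤ (gain k * 3) (ℕₚ.≤-pred (m%n<n (2 * k ∸ 2) 3))) ⟩
  2 + (2 + gain k * 3)                   ≡⟨ regroup (gain k) ⟩
  3 * gain k + 4                         ∎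
  where
  open ℕₚ.≤-Reasoning
  regroup : ∀ q → 2 + (2 + q * 3) ≡ 3 * q + 4
  regroup q = solve (q ∷ [])

Rises : ℕ → (ℕ → ℤ) → Set
Rises r f = ∀ j n → 2 * n + r < 3 * j → 3^ n ∣ f j

rises-weaken : ∀ {r r' f} → r ≤ r' → Rises r f → Rises r' f
rises-weaken r≤r' h j n lt = h j n (ℕₚ.≤-<-trans (ℕₚ.+-monoʳ-≤ (2 * n) r≤r') lt)

rises-scale : ∀ {r f} (c : ℤ) v → 3^ v ∣ c → Rises (2 * v + r) f → Rises r (λ j → c *ᶻ f j)
rises-scale {r} {f} c v hc h j n lt =
  subst (3^ n ∣_) (ℤₚ.*-comm (f j) c) (∣-split 0 n v from-f hc)
  where
  regroup : ∀ p v r → 2 * (p + v) + r ≡ 2 * p + (2 * v + r)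
  regroup p v r = solve (p ∷ v ∷ r ∷ [])
  from-f : ∀ p → n ≡ p + v → 3^ p ∣ f j
  from-f p refl = h j p (subst (_< 3 * j) (regroup p v r) lt)

rises-shift : ∀ {r f} s → Rises r f → Rises (3 * s + r) (shift f s)
rises-shift {r} {f} s h j n lt with j ≤ᵇ s in eq
... | true  = ∣-zero
... | false = h (j ∸ s) n (cancel (subst (λ u → 2 * n + (3 * s + r) < 3 * u) (sym s+[j∸s]≡j) lt))
  where
  s+[j∸s]≡j : s + (j ∸ s) ≡ j
  s+[j∸s]≡j = ℕₚ.m+[n∸m]≡n (ℕₚ.<⇒≤ (ℕₚ.≰⇒> λ j≤s → subst T eq (ℕₚ.≤⇒≤ᵇ j≤s)))
  regroup : ∀ n s r o → (1 + (2 * n + (3 * s + r)) ≡ 3 * s + (1 + (2 * n + r)))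
                      × (3 * (s + o) ≡ 3 * s + 3 * o)
  regroup n s r o = solve (n ∷ s ∷ r ∷ o ∷ []) , solve (s ∷ o ∷ [])
  cancel : ∀ {o} → 2 * n + (3 * s + r) < 3 * (s + o) → 2 * n + r < 3 * o
  cancel {o} lt′ with regroup n s r o
  ... | e₁ , e₂ = ℕₚ.+-cancelˡ-≤ (3 * s) _ _ (subst₂ _≤_ e₁ e₂ lt′)

Checked : (ℕ → ℕ) → (ℕ → ℤ) → ℕ → Set
Checked bound f zero    = ⊤
Checked bound f (suc N) = Checked bound f N × True (3 ^ bound (suc N) ℕ∣.∣? ℤ.∣ f (suc N) ∣)

checked-divisible : ∀ bound f N → Checked bound f N → ∀ j → 1 ≤ j → j ≤ N → 3^ bound j ∣ f j
checked-divisible bound f zero    _           (suc j) _   ()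
checked-divisible bound f (suc N) (rest , ok) j       1≤j j≤1+N with ℕₚ.m≤n⇒m<n∨m≡n j≤1+N
... | inj₁ (s≤s j≤N) = checked-divisible bound f N rest j 1≤j j≤N
... | inj₂ refl      = pow∣ (∣ᵤ⇒∣ (toWitness ok))

finitely-divisible : ∀ bound N f → (∀ k → f (N + suc k) ≡ + 0) → Checked bound f N →
                     ∀ j → 1 ≤ j → 3^ bound j ∣ f j
finitely-divisible bound N f vanish ok j 1≤j with j ≤? N
... | yes j≤N = checked-divisible bound f N ok j 1≤j j≤N
... | no j≰N with ℕₚ.m≤n⇒∃[o]m+o≡n (ℕₚ.≰⇒> j≰N)
...   | o , refl = subst (3^ bound (suc N + o) ∣_) (sym f[1+N+o]≡0) ∣-zero
  where
  f[1+N+o]≡0 : f (suc (N + o)) ≡ + 0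
  f[1+N+o]≡0 = trans (cong f (sym (ℕₚ.+-suc N o))) (vanish o)

rises-finite : ∀ r N f → (∀ k → f (N + suc k) ≡ + 0) →
               {Checked (λ j → (3 * j ∸ suc r) / 2) f N} → Rises r f
rises-finite r N f vanish zero    n ()
rises-finite r N f vanish {ok} (suc j) n lt =
  ∣-weaken (≤-quotient 2 (suc r) (subst (_≤ 3 * suc j) (sym (ℕₚ.+-suc (2 * n) r)) lt))
           (finitely-divisible _ N f vanish ok (suc j) (s≤s z≤n))

rises-recur : ∀ {m1 m2 m3 i} → Rises (3 + i) m1 → Rises (2 + i) m2 → Rises (1 + i) m3 →
              Rises (4 + i) (recur m1 m2 m3)
rises-recur {i = i} h1 h2 h3 j n lt =
  ∣-+ (∣-+ (∣-- (∣-+ (∣--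
    (rises-scale (+ 30) 1 (∣-lit (+ 30) 1) (rises-shift 1 h1) j n lt)
    (rises-scale (+ 108) 3 (∣-lit (+ 108) 3) (rises-weaken (ℕₚ.n≤1+n (9 + i)) (rises-shift 2 h1)) j n lt))
    (rises-scale (+ 81) 4 (∣-lit (+ 81) 4) (rises-shift 3 h1) j n lt))
    (rises-scale (+ 12) 1 (∣-lit (+ 12) 1) (rises-weaken (ℕₚ.n≤1+n (5 + i)) (rises-shift 1 h2)) j n lt))
    (rises-scale (+ 9) 2 (∣-lit (+ 9) 2) (rises-shift 2 h2) j n lt))
    (rises-shift 1 h3 j n lt)

a-rises : ∀ i → Rises i (a i)
a-rises zero j n _ = ∣-zero
a-rises 1 = rises-finite 1 3 (a 1) (λ _ → refl)
a-rises 2 = rises-finite 2 6 (a 2) (λ _ → refl)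
a-rises 3 = rises-finite 3 9 (a 3) (λ _ → refl)
a-rises (suc (suc (suc (suc i)))) =
  rises-recur (a-rises (suc (suc (suc i)))) (a-rises (suc (suc i))) (a-rises (suc i))

b-rises : ∀ i → Rises i (b i)
b-rises zero j n _ = ∣-zero
b-rises 1 = rises-finite 1 4 (b 1) (λ _ → refl)
b-rises 2 = rises-finite 2 7 (b 2) (λ _ → refl)
b-rises 3 = rises-finite 3 10 (b 3) (λ _ → refl)
b-rises (suc (suc (suc (suc i)))) =
  rises-recur (b-rises (suc (suc (suc i)))) (b-rises (suc (suc i))) (b-rises (suc i))

OddBound : ℕ → (ℕ → ℤ) → Set
OddBound E f = ∀ k n → 3 * n + 2 ≤ 2 * k → 3^ (E + n) ∣ f k

evenGain : ℕ → ℕ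
evenGain 1 = 0
evenGain j = j

EvenBound : ℕ → (ℕ → ℤ) → Set
EvenBound E f = ∀ j → 3^ (E + evenGain (suc j)) ∣ f (suc j)

odd-bound-finite : ∀ E N f → (∀ k → f (N + suc k) ≡ + 0) → {Checked (λ k → E + gain k) f N} →
                   OddBound E f
odd-bound-finite E N f vanish zero n h with ℕₚ.m+n≤o⇒n≤o (3 * n) h
... | ()
odd-bound-finite E N f vanish {ok} (suc k) n h =
  ∣-weaken (ℕₚ.+-monoʳ-≤ E (≤-quotient 3 2 h))
           (finitely-divisible _ N f vanish ok (suc k) (s≤s z≤n))

d₁-bound : OddBound 2 (d 1)
d₁-bound = odd-bound-finite 2 1 (d 1) (λ _ → refl)

b₁-bound : OddBound 2 (b 1)
b₁-bound = odd-bound-finite 2 4 (b 1) (λ _ → refl)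

-- In a summand a(K, J)·d(K) with J ≥ 3, d(K) carries ⌊(2K-2)/3⌋ = q of the gain J
-- and row K of a, rising with offset K, carries the remaining p = J - q.
even-split : ∀ {K q p J} → 2 * K ≤ 3 * q + 4 → 3 ≤ J → J ≡ p + q → 2 * p + K < 3 * J
even-split {K} {q} {p} hK hJ refl = ℕₚ.*-cancelˡ-≤ 2 (begin
  2 * suc (2 * p + K)                  ≡⟨ solve (p ∷ K ∷ []) ⟩
  2 * K + (4 * p + 2)                  ≤⟨ ℕₚ.+-monoˡ-≤ (4 * p + 2) hK ⟩
  3 * q + 4 + (4 * p + 2)              ≡⟨ solve (p ∷ q ∷ []) ⟩
  2 * 3 + (4 * p + 3 * q)              ≤⟨ ℕₚ.+-monoˡ-≤ (4 * p + 3 * q) (ℕₚ.*-monoʳ-≤ 2 hJ) ⟩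
  2 * (p + q) + (4 * p + 3 * q)        ≤⟨ ℕₚ.m≤m+n _ q ⟩
  2 * (p + q) + (4 * p + 3 * q) + q    ≡⟨ solve (p ∷ q ∷ []) ⟩
  2 * (3 * (p + q))                    ∎)
  where open ℕₚ.≤-Reasoning

-- Column 2 of a: rows 1-3 are -36, 306, -360, all divisible by 9;
-- from row 4 on, d(K) alone is divisible by 3^(E + 2).
even-column-two : ∀ {E f} → OddBound E f → ∀ k → 3^ (E + 2) ∣ a (suc k) 2 *ᶻ f (suc k)
even-column-two {E} {f} odd = column
  where
  exponent : 2 + (E + 0) ≡ E + 2
  exponent = solve (E ∷ [])
  entry-times-d : ∀ k → 3^ 2 ∣ a (suc k) 2 → 3^ (E + 2) ∣ a (suc k) 2 *ᶻ f (suc k)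
  entry-times-d k h = subst (λ u → 3^ u ∣ a (suc k) 2 *ᶻ f (suc k)) exponent
                            (∣-* h (odd (suc k) 0 (ℕₚ.*-monoʳ-≤ 2 (s≤s z≤n))))
  column : ∀ k → 3^ (E + 2) ∣ a (suc k) 2 *ᶻ f (suc k)
  column 0 = entry-times-d 0 (∣-lit (- + 36) 2)
  column 1 = entry-times-d 1 (∣-lit (+ 306) 2)
  column 2 = entry-times-d 2 (∣-lit (- + 360) 2)
  column (suc (suc (suc k))) = ∣-*ˡ (a (4 + k) 2) (odd (4 + k) 2 (ℕₚ.*-monoʳ-≤ 2 (ℕₚ.m≤m+n 4 k)))

even-term : ∀ {E f} → OddBound E f → ∀ j k →
            3^ (E + evenGain (suc j)) ∣ a (suc k) (suc j) *ᶻ f (suc k)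
even-term odd zero k = ∣-*ˡ (a (suc k) 1) (odd (suc k) 0 (ℕₚ.*-monoʳ-≤ 2 (s≤s z≤n)))
even-term odd 1 k = even-column-two odd k
even-term {E} odd (suc (suc j)) k =
  ∣-split E (3 + j) q
    (λ p J≡p+q → a-rises (suc k) (3 + j) p
                   (even-split {suc k} {q} {p} (gain-upper (suc k)) (s≤s (s≤s (s≤s z≤n))) J≡p+q))
    (odd (suc k) q (gain-lower (suc k) (s≤s z≤n)))
  where
  q : ℕ
  q = gain (suc k)

-- In a summand b(K, l)·d(K) with K ≥ 2, d(K) carries K of the required 2 + n
-- and row K of b, rising with offset K, carries the remaining p.
odd-split : ∀ {K n p l} → 2 ≤ K → 2 + n ≡ p + K → 3 * n + 2 ≤ 2 * l → 2 * p + K < 3 * l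
odd-split {K} {n} {p} {l} hK eq h = ℕₚ.≤-trans to-2n+3 2n+3≤3l
  where
  open ℕₚ.≤-Reasoning
  to-2n+3 : suc (2 * p + K) ≤ 2 * n + 3
  to-2n+3 = ℕₚ.+-cancelˡ-≤ 2 _ _ (begin
    2 + suc (2 * p + K)   ≤⟨ ℕₚ.+-monoˡ-≤ (suc (2 * p + K)) hK ⟩
    K + suc (2 * p + K)   ≡⟨ solve (K ∷ p ∷ []) ⟩
    1 + 2 * (p + K)       ≡⟨ cong (λ u → 1 + 2 * u) (sym eq) ⟩
    1 + 2 * (2 + n)       ≡⟨ solve (n ∷ []) ⟩
    2 + (2 * n + 3)       ∎)
  1≤l : 1 ≤ l
  1≤l = ℕₚ.*-cancelˡ-≤ 2 (ℕₚ.m+n≤o⇒n≤o (3 * n) h)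
  2n+3≤3l : 2 * n + 3 ≤ 3 * l
  2n+3≤3l = begin
    2 * n + 3             ≤⟨ ℕₚ.+-monoˡ-≤ 3 (ℕₚ.*-monoˡ-≤ n (ℕₚ.n≤1+n 2)) ⟩
    3 * n + 3             ≡⟨ ℕₚ.+-suc (3 * n) 2 ⟩
    suc (3 * n + 2)       ≤⟨ s≤s h ⟩
    1 + 2 * l             ≡⟨ ℕₚ.+-comm 1 (2 * l) ⟩
    2 * l + 1             ≤⟨ ℕₚ.+-monoʳ-≤ (2 * l) 1≤l ⟩
    2 * l + l             ≡⟨ solve (l ∷ []) ⟩
    3 * l                 ∎

-- each summand b(k, l)·d(k) of an odd-index vector meets the odd bound;
-- for k = 1 the whole 2 + n comes from b(1, l)
odd-term : ∀ {E g} → EvenBound E g → ∀ l n → 3 * n + 2 ≤ 2 * l → ∀ k →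
           3^ (E + (2 + n)) ∣ b (suc k) l *ᶻ g (suc k)
odd-term {E} {g} even l n h zero =
  subst (λ u → 3^ u ∣ b 1 l *ᶻ g 1) exponent (∣-* (b₁-bound l n h) (even 0))
  where
  exponent : 2 + n + (E + 0) ≡ E + (2 + n)
  exponent = solve (E ∷ n ∷ [])
odd-term {E} even l n h (suc k) =
  ∣-split E (2 + n) (2 + k)
    (λ p eq → b-rises (2 + k) l p (odd-split {2 + k} {n} {p} {l} (s≤s (s≤s z≤n)) eq h))
    (even (suc k))

even-step : ∀ α {E} → isEven (suc (suc α)) ≡ true →
            OddBound E (d (suc α)) → EvenBound E (d (suc (suc α)))
even-step α {E} parity odd j =
  ∣-sum (suppBound (suc α)) _ λ k →
    subst (λ e → 3^ (E + evenGain (suc j)) ∣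
                 (if e then a (suc k) (suc j) else b (suc k) (suc j)) *ᶻ d (suc α) (suc k))
          (sym parity) (even-term odd j k)

odd-step : ∀ α {E} → isEven (suc (suc α)) ≡ false →
           EvenBound E (d (suc α)) → OddBound (E + 2) (d (suc (suc α)))
odd-step α {E} parity even l n h =
  subst (λ u → 3^ u ∣ d (suc (suc α)) l) (sym (ℕₚ.+-assoc E 2 n)) (∣-sum (suppBound (suc α)) _ λ k →
    subst (λ e → 3^ (E + (2 + n)) ∣ (if e then a (suc k) l else b (suc k) l) *ᶻ d (suc α) (suc k))
          (sym parity) (odd-term {g = d (suc α)} even l n h k))

even-parity : ∀ β → isEven (β + β) ≡ true
even-parity zero    = refl
even-parity (suc β) rewrite ℕₚ.+-suc β β = even-parity β

odd-parity : ∀ β → isEven (suc (β + β)) ≡ false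
odd-parity zero    = refl
odd-parity (suc β) rewrite ℕₚ.+-suc β β = odd-parity β

odd-bound : ∀ β → OddBound (2 * suc β) (d (suc (β + β)))
odd-bound zero    = d₁-bound
odd-bound (suc β) =
  subst₂ OddBound exponent (cong (λ i → d (suc (suc i))) (sym (ℕₚ.+-suc β β)))
    (odd-step (suc (β + β)) (odd-parity β) (even-step (β + β) (even-parity β) (odd-bound β)))
  where
  exponent : 2 * suc β + 2 ≡ 2 * suc (suc β)
  exponent = solve (β ∷ [])

theorem3p3 : (α j : ℕ) → 1 ≤ α → 1 ≤ j →
    ord3≥ (d (2 * α ∸ 1) j) (2 * α + (2 * j ∸ 2) / 3)
theorem3p3 (suc β) (suc j) _ _ =
  ∣⇒∣ᵤ (divides-x (subst (λ i → 3^ (2 * suc β + gain (suc j)) ∣ d i (suc j)) (sym index)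
              (odd-bound β (suc j) (gain (suc j)) (gain-lower (suc j) (s≤s z≤n)))))
  where
  index : 2 * suc β ∸ 1 ≡ suc (β + β)
  index = trans (ℕₚ.+-suc β (β + 0)) (cong (λ u → suc (β + u)) (ℕₚ.+-identityʳ β))
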